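{- For every real $x\in{^{co}\mathbf{I}}$ we have $x\in[\frac18,1]$ or $x\in[-1,-\frac18]$ or $x\in[-\frac14,\frac14]$.
   Context: Constructive setting: the disjunction is constructive. $\mathbf{Sd}=\{ -1,0,1\}$. ${^{co}\mathbf{I}}$ is the greatest fixed point of $\Phi(X)=\{x \mid \exists_{d\in\mathbf{Sd}}\exists_{x'}(x'\in X\wedge |x'|\le 1\wedge x=\frac{d+x'}{2})\}$ (so ${^{co}\mathbf{I}}\subseteq\Phi({^{co}\mathbf{I}})$, and any $X\subseteq\Phi({^{co}\mathbf{I}}\cup X)$ satisfies $X\subseteq{^{co}\mathbf{I}}$). -}

module Defs where

open import Level using (0ℓ)
open import Data.Product using (Σ; _×_; _,_)
open import Data.Sum using (_⊎_)
open import Relation.Nullary using (¬_)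
open import Relation.Binary using (Rel; IsStrictPartialOrder)
open import Algebra.Core using (Op₁; Op₂)
open import Algebra.Structures using (IsCommutativeRing)

record RealField : Set₁ where
  infixl 7 _*_
  infixl 6 _+_
  infix 4 _≈_ _<_ _≤_
  field
    Carrier : Set
    _≈_     : Rel Carrier 0ℓ
    _+_     : Op₂ Carrier
    _*_     : Op₂ Carrier
    -_      : Op₁ Carrier
    0#      : Carrier
    1#      : Carrier
    isCommutativeRing : IsCommutativeRing _≈_ _+_ _*_ -_ 0# 1#
    _<_     : Rel Carrier 0ℓ
    <-isStrictPartialOrder : IsStrictPartialOrder _≈_ _<_
    -- cotransitivity (constructive replacement of trichotomy)
    <-cotrans : ∀ {x y} → x < y → ∀ z → (x < z) ⊎ (z < y)
    ¬#⇒≈    : ∀ {x y} → ¬ (x < y) → ¬ (y < x) → x ≈ y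
    ≈⇒¬<    : ∀ {x y} → x ≈ y → ¬ (x < y)
    +-monoˡ-< : ∀ {x y} z → x < y → x + z < y + z
    *-pos   : ∀ {x y} → 0# < x → 0# < y → 0# < x * y
    0<1     : 0# < 1#
    inverse : ∀ x → (x < 0#) ⊎ (0# < x) → Σ Carrier (λ y → x * y ≈ 1#)
    ½       : Carrier
    ½+½≈1   : ½ + ½ ≈ 1#

  _≤_ : Rel Carrier 0ℓ
  x ≤ y = ¬ (y < x)

  ¼ : Carrier
  ¼ = ½ * ½

  ⅛ : Carrier
  ⅛ = ½ * ½ * ½

data Sd : Set where
  -1ᵈ 0ᵈ 1ᵈ : Sd

module _ (R : RealField) where
  open RealField R

  ⟦_⟧ : Sd → Carrier
  ⟦ -1ᵈ ⟧ = - 1#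
  ⟦ 0ᵈ ⟧  = 0#
  ⟦ 1ᵈ ⟧  = 1#

  -- Φ(X) = { x | ∃ d ∈ Sd, ∃ x' (x' ∈ X ∧ |x'| ≤ 1 ∧ x = (d + x')/2) }
  -- (|x'| ≤ 1 written as -1 ≤ x' ∧ x' ≤ 1; (d+x')/2 written as ½ * (d + x'))
  Φ : (Carrier → Set) → Carrier → Set
  Φ X x = Σ Sd λ d → Σ Carrier λ x' →
            X x' × ((- 1#) ≤ x' × x' ≤ 1#) × x ≈ ½ * (⟦ d ⟧ + x')

  -- coI = greatest fixed point of Φ = union of all post-fixed points
  -- (Knaster–Tarski): x ∈ coI iff x ∈ X for some X ⊆ Φ(X).
  CoI : Carrier → Set₁
  CoI x = Σ (Carrier → Set) λ X → (∀ y → X y → Φ X y) × X x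

-- Shifting by one turns the signed digits d ∈ {-1, 0, 1} into natural digits
-- d + 1 ∈ {0, 1, 2}. Unfolding x ∈ coI three times then gives
-- 8 (x + 1) = N + w with N = 4 e₁ + 2 e₂ + e₃ ∈ {0, …, 14} and w ∈ [0, 2],
-- so x lies in [(N - 8)/8, (N - 6)/8]. This interval is contained in
-- [-1, -1/8] when N ≤ 5, in [-1/4, 1/4] when 6 ≤ N ≤ 8, and in [1/8, 1] when N ≥ 9.
module Submission where

open import Defs
open import Level using (0ℓ)
open import Data.Nat as ℕ using (ℕ; z≤n; s≤s)
import Data.Nat.Properties as ℕ
open import Data.Product using (_×_; _,_; proj₁; proj₂)
open import Data.Sum using (_⊎_; inj₁; inj₂)
open import Relation.Nullary using (yes; no)
open import Relation.Binary.PropositionalEquality as ≡ using (_≡_; cong)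
open import Relation.Binary using (IsStrictPartialOrder; IsPreorder; Preorder)
open import Algebra.Bundles using (CommutativeRing)
import Algebra.Properties.Monoid.Mult as MonoidMult
import Algebra.Properties.CommutativeSemigroup as CommutativeSemigroupProperties
import Relation.Binary.Reasoning.Setoid as SetoidReasoning
import Relation.Binary.Reasoning.Preorder as PreorderReasoning

module RealFieldProperties (R : RealField) where
  open RealField R

  commutativeRing : CommutativeRing 0ℓ 0ℓ
  commutativeRing = record { isCommutativeRing = isCommutativeRing }

  open CommutativeRing commutativeRing public
    using ( setoid; isEquivalence; refl; sym; trans; +-cong; +-congˡ; *-congˡ; *-congʳ
          ; +-assoc; +-comm; +-identityˡ; +-identityʳ; -‿inverseˡ; -‿inverseʳ
          ; distribˡ; distribʳ; *-identityˡ; *-identityʳ; *-assoc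
          ; +-monoid; +-commutativeSemigroup )
  open MonoidMult +-monoid using (×-homo-1; ×-homo-+) renaming (_×_ to _×ₙ_)
  open IsStrictPartialOrder <-isStrictPartialOrder
    using (<-resp-≈) renaming (trans to <-trans; irrefl to <-irrefl)
  module ≈-Reasoning = SetoidReasoning setoid

  ≈⇒≤ : ∀ {x y} → x ≈ y → x ≤ y
  ≈⇒≤ x≈y = ≈⇒¬< (sym x≈y)

  ≤-trans : ∀ {x y z} → x ≤ y → y ≤ z → x ≤ z
  ≤-trans {y = y} x≤y y≤z z<x with <-cotrans z<x y
  ... | inj₁ z<y = y≤z z<y
  ... | inj₂ y<x = x≤y y<x

  ≤-isPreorder : IsPreorder _≈_ _≤_
  ≤-isPreorder = record
    { isEquivalence = isEquivalence ; reflexive = ≈⇒≤ ; trans = ≤-trans }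

  ≤-preorder : Preorder 0ℓ 0ℓ 0ℓ
  ≤-preorder = record { isPreorder = ≤-isPreorder }

  module ≤-Reasoning = PreorderReasoning ≤-preorder

  0≤1 : 0# ≤ 1#
  0≤1 1<0 = <-irrefl refl (<-trans 0<1 1<0)

  x+y-y≈x : ∀ x y → x + y + - y ≈ x
  x+y-y≈x x y = trans (+-assoc x y (- y)) (trans (+-congˡ (-‿inverseʳ y)) (+-identityʳ x))

  +-monoˡ-≤ : ∀ z {x y} → x ≤ y → x + z ≤ y + z
  +-monoˡ-≤ z {x} {y} x≤y y+z<x+z =
    x≤y (proj₂ <-resp-≈ (x+y-y≈x y z) (proj₁ <-resp-≈ (x+y-y≈x x z) (+-monoˡ-< (- z) y+z<x+z)))

  +-monoʳ-≤ : ∀ z {x y} → x ≤ y → z + x ≤ z + y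
  +-monoʳ-≤ z {x} {y} x≤y = begin
    z + x ≈⟨ +-comm z x ⟩
    x + z ≲⟨ +-monoˡ-≤ z x≤y ⟩
    y + z ≈⟨ +-comm y z ⟩
    z + y ∎
    where open ≤-Reasoning

  +-mono-≤ : ∀ {x y u v} → x ≤ y → u ≤ v → x + u ≤ y + v
  +-mono-≤ {y = y} {u} x≤y u≤v = ≤-trans (+-monoˡ-≤ u x≤y) (+-monoʳ-≤ y u≤v)

  +-cancelʳ-≤ : ∀ z {x y} → x + z ≤ y + z → x ≤ y
  +-cancelʳ-≤ z x+z≤y+z y<x = x+z≤y+z (+-monoˡ-< z y<x)

  x≤x+y : ∀ {x y} → 0# ≤ y → x ≤ x + y
  x≤x+y {x} {y} 0≤y = begin
    x      ≈⟨ +-identityʳ x ⟨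
    x + 0# ≲⟨ +-monoʳ-≤ x 0≤y ⟩
    x + y  ∎
    where open ≤-Reasoning

  ½*x+½*x≈x : ∀ x → ½ * x + ½ * x ≈ x
  ½*x+½*x≈x x = begin
    ½ * x + ½ * x ≈⟨ distribʳ x ½ ½ ⟨
    (½ + ½) * x   ≈⟨ *-congʳ ½+½≈1 ⟩
    1# * x        ≈⟨ *-identityˡ x ⟩
    x             ∎
    where open ≈-Reasoning

  ½*[x+x]≈x : ∀ x → ½ * (x + x) ≈ x
  ½*[x+x]≈x x = trans (distribˡ ½ x x) (½*x+½*x≈x x)

  ½*-mono-≤ : ∀ {x y} → x ≤ y → ½ * x ≤ ½ * y
  ½*-mono-≤ {x} {y} x≤y ½y<½x =
    x≤y (proj₂ <-resp-≈ (½*x+½*x≈x y) (proj₁ <-resp-≈ (½*x+½*x≈x x) ½y+½y<½x+½x))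
    where
    ½y+½y<½x+½x : ½ * y + ½ * y < ½ * x + ½ * x
    ½y+½y<½x+½x = <-trans (+-monoˡ-< (½ * y) ½y<½x)
                          (proj₂ <-resp-≈ (+-comm (½ * y) (½ * x)) (+-monoˡ-< (½ * x) ½y<½x))

  ι : ℕ → Carrier
  ι n = n ×ₙ 1#

  ι-+ : ∀ m n → ι (m ℕ.+ n) ≈ ι m + ι n
  ι-+ = ×-homo-+ 1#

  ι-1 : ι 1 ≈ 1#
  ι-1 = ×-homo-1 1#

  ι-2 : ι 2 ≈ 1# + 1#
  ι-2 = trans (ι-+ 1 1) (+-cong ι-1 ι-1)

  0≤ι : ∀ n → 0# ≤ ι n
  0≤ι ℕ.zero    = ≈⇒≤ refl
  0≤ι (ℕ.suc n) = begin
    0#       ≈⟨ +-identityʳ 0# ⟨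
    0# + 0#  ≲⟨ +-mono-≤ 0≤1 (0≤ι n) ⟩
    1# + ι n ∎
    where open ≤-Reasoning

  ι-mono-≤ : ∀ {m n} → m ℕ.≤ n → ι m ≤ ι n
  ι-mono-≤ {n = n} z≤n = 0≤ι n
  ι-mono-≤ (s≤s m≤n)   = +-monoʳ-≤ 1# (ι-mono-≤ m≤n)

  ½*ι[n+n]≈ι : ∀ n → ½ * ι (n ℕ.+ n) ≈ ι n
  ½*ι[n+n]≈ι n = trans (*-congˡ (ι-+ n n)) (½*[x+x]≈x (ι n))

  eighths : Carrier → Carrier
  eighths x = ½ * (½ * (½ * x))

  eighths-mono-≤ : ∀ {x y} → x ≤ y → eighths x ≤ eighths y
  eighths-mono-≤ x≤y = ½*-mono-≤ (½*-mono-≤ (½*-mono-≤ x≤y))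

  eighths-ι-+ : ∀ m n → eighths (ι (m ℕ.+ n)) ≈ eighths (ι m) + eighths (ι n)
  eighths-ι-+ m n = begin
    ½ * (½ * (½ * ι (m ℕ.+ n)))                     ≈⟨ *-congˡ (*-congˡ (*-congˡ (ι-+ m n))) ⟩
    ½ * (½ * (½ * (ι m + ι n)))                     ≈⟨ *-congˡ (*-congˡ (distribˡ ½ (ι m) (ι n))) ⟩
    ½ * (½ * (½ * ι m + ½ * ι n))                   ≈⟨ *-congˡ (distribˡ ½ (½ * ι m) (½ * ι n)) ⟩
    ½ * (½ * (½ * ι m) + ½ * (½ * ι n))             ≈⟨ distribˡ ½ (½ * (½ * ι m)) (½ * (½ * ι n)) ⟩
    ½ * (½ * (½ * ι m)) + ½ * (½ * (½ * ι n))       ∎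
    where open ≈-Reasoning

  eighths-ι-1 : eighths (ι 1) ≈ ⅛
  eighths-ι-1 = begin
    ½ * (½ * (½ * ι 1)) ≈⟨ *-congˡ (*-congˡ (*-congˡ ι-1)) ⟩
    ½ * (½ * (½ * 1#))  ≈⟨ *-congˡ (*-congˡ (*-identityʳ ½)) ⟩
    ½ * (½ * ½)         ≈⟨ *-assoc ½ ½ ½ ⟨
    ½ * ½ * ½           ∎
    where open ≈-Reasoning

  eighths-ι-2 : eighths (ι 2) ≈ ¼
  eighths-ι-2 = begin
    ½ * (½ * (½ * ι 2)) ≈⟨ *-congˡ (*-congˡ (½*ι[n+n]≈ι 1)) ⟩
    ½ * (½ * ι 1)       ≈⟨ *-congˡ (*-congˡ ι-1) ⟩
    ½ * (½ * 1#)        ≈⟨ *-congˡ (*-identityʳ ½) ⟩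
    ½ * ½               ∎
    where open ≈-Reasoning

  eighths-ι-8 : eighths (ι 8) ≈ 1#
  eighths-ι-8 = begin
    ½ * (½ * (½ * ι 8)) ≈⟨ *-congˡ (*-congˡ (½*ι[n+n]≈ι 4)) ⟩
    ½ * (½ * ι 4)       ≈⟨ *-congˡ (½*ι[n+n]≈ι 2) ⟩
    ½ * ι 2             ≈⟨ ½*ι[n+n]≈ι 1 ⟩
    ι 1                 ≈⟨ ι-1 ⟩
    1#                  ∎
    where open ≈-Reasoning

  +1≈eighths : ∀ {a} k → eighths (ι k) ≈ a → a + 1# ≈ eighths (ι (k ℕ.+ 8))
  +1≈eighths {a} k eq = begin
    a + 1#                        ≈⟨ +-cong eq eighths-ι-8 ⟨
    eighths (ι k) + eighths (ι 8) ≈⟨ eighths-ι-+ k 8 ⟨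
    eighths (ι (k ℕ.+ 8))         ∎
    where open ≈-Reasoning

  -x+[x+y]≈y : ∀ x y → - x + (x + y) ≈ y
  -x+[x+y]≈y x y = begin
    - x + (x + y) ≈⟨ +-assoc (- x) x y ⟨
    - x + x + y   ≈⟨ +-cong (-‿inverseˡ x) refl ⟩
    0# + y        ≈⟨ +-identityˡ y ⟩
    y             ∎
    where open ≈-Reasoning

  neg+1≈eighths : ∀ {a} j k → j ℕ.+ k ≡ 8 → eighths (ι j) ≈ a → - a + 1# ≈ eighths (ι k)
  neg+1≈eighths {a} j k j+k≡8 eq = begin
    - a + 1#                        ≈⟨ +-congˡ eighths-ι-8 ⟨
    - a + eighths (ι 8)             ≡⟨ cong (λ n → - a + eighths (ι n)) j+k≡8 ⟨
    - a + eighths (ι (j ℕ.+ k))     ≈⟨ +-congˡ (eighths-ι-+ j k) ⟩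
    - a + (eighths (ι j) + eighths (ι k)) ≈⟨ +-congˡ (+-cong eq refl) ⟩
    - a + (a + eighths (ι k))       ≈⟨ -x+[x+y]≈y a (eighths (ι k)) ⟩
    eighths (ι k)                   ∎
    where open ≈-Reasoning

module Expansion (R : RealField) where
  open RealField R
  open RealFieldProperties R
  open CommutativeSemigroupProperties +-commutativeSemigroup using (interchange)

  digit : Sd → ℕ
  digit -1ᵈ = 0
  digit 0ᵈ  = 1
  digit 1ᵈ  = 2

  digit≤2 : ∀ d → digit d ℕ.≤ 2
  digit≤2 -1ᵈ = z≤n
  digit≤2 0ᵈ  = s≤s z≤n
  digit≤2 1ᵈ  = s≤s (s≤s z≤n)

  ⟦d⟧+1≈ι[digit] : ∀ d → ⟦_⟧ R d + 1# ≈ ι (digit d)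
  ⟦d⟧+1≈ι[digit] -1ᵈ = -‿inverseˡ 1#
  ⟦d⟧+1≈ι[digit] 0ᵈ  = trans (+-identityˡ 1#) (sym ι-1)
  ⟦d⟧+1≈ι[digit] 1ᵈ  = sym ι-2

  shift-digit : ∀ {x y} d → x ≈ ½ * (⟦_⟧ R d + y) → x + 1# ≈ ½ * (ι (digit d) + (y + 1#))
  shift-digit {x} {y} d x≈ = begin
    x + 1#                               ≈⟨ +-cong x≈ (sym (½*[x+x]≈x 1#)) ⟩
    ½ * (⟦_⟧ R d + y) + ½ * (1# + 1#)    ≈⟨ distribˡ ½ _ _ ⟨
    ½ * ((⟦_⟧ R d + y) + (1# + 1#))      ≈⟨ *-congˡ (interchange (⟦_⟧ R d) y 1# 1#) ⟩
    ½ * ((⟦_⟧ R d + 1#) + (y + 1#))      ≈⟨ *-congˡ (+-cong (⟦d⟧+1≈ι[digit] d) refl) ⟩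
    ½ * (ι (digit d) + (y + 1#))         ∎
    where open ≈-Reasoning

  ι+½*[ι+y] : ∀ n e y → ι n + ½ * (ι e + y) ≈ ½ * (ι (n ℕ.+ n ℕ.+ e) + y)
  ι+½*[ι+y] n e y = begin
    ι n + ½ * (ι e + y)               ≈⟨ +-cong (½*[x+x]≈x (ι n)) refl ⟨
    ½ * (ι n + ι n) + ½ * (ι e + y)   ≈⟨ distribˡ ½ _ _ ⟨
    ½ * ((ι n + ι n) + (ι e + y))     ≈⟨ *-congˡ (+-assoc _ _ _) ⟨
    ½ * ((ι n + ι n) + ι e + y)       ≈⟨ *-congˡ (+-cong ι[n+n+e] refl) ⟨
    ½ * (ι (n ℕ.+ n ℕ.+ e) + y)       ∎
    where
    open ≈-Reasoning
    ι[n+n+e] : ι (n ℕ.+ n ℕ.+ e) ≈ (ι n + ι n) + ι e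
    ι[n+n+e] = trans (ι-+ (n ℕ.+ n) e) (+-cong (ι-+ n n) refl)

  record EighthsExpansion (x : Carrier) : Set where
    field
      N    : ℕ
      N≤14 : N ℕ.≤ 14
      w    : Carrier
      0≤w  : 0# ≤ w
      w≤2  : w ≤ 1# + 1#
      x+1≈eighths : x + 1# ≈ eighths (ι N + w)

  expansion : ∀ {X : Carrier → Set} {x} → (∀ y → X y → Φ R X y) → X x → EighthsExpansion x
  expansion step Xx with step _ Xx
  ... | d₁ , x₁ , Xx₁ , _ , x≈ with step _ Xx₁
  ... | d₂ , x₂ , Xx₂ , _ , x₁≈ with step _ Xx₂
  ... | d₃ , u , _ , (-1≤u , u≤1) , x₂≈ = record
    { N    = N₃
    ; N≤14 = ℕ.+-mono-≤ (ℕ.+-mono-≤ N₂≤6 N₂≤6) (digit≤2 d₃)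
    ; w    = u + 1#
    ; 0≤w  = ≤-trans (≈⇒≤ (sym (-‿inverseˡ 1#))) (+-monoˡ-≤ 1# -1≤u)
    ; w≤2  = +-monoˡ-≤ 1# u≤1
    ; x+1≈eighths = begin
        _ + 1#                                          ≈⟨ shift-digit d₁ x≈ ⟩
        ½ * (ι e₁ + (x₁ + 1#))                          ≈⟨ *-congˡ (+-congˡ (shift-digit d₂ x₁≈)) ⟩
        ½ * (ι e₁ + ½ * (ι e₂ + (x₂ + 1#)))             ≈⟨ *-congˡ (ι+½*[ι+y] e₁ e₂ _) ⟩
        ½ * (½ * (ι N₂ + (x₂ + 1#)))                    ≈⟨ *-congˡ (*-congˡ (+-congˡ (shift-digit d₃ x₂≈))) ⟩
        ½ * (½ * (ι N₂ + ½ * (ι e₃ + (u + 1#))))        ≈⟨ *-congˡ (*-congˡ (ι+½*[ι+y] N₂ e₃ _)) ⟩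
        ½ * (½ * (½ * (ι N₃ + (u + 1#))))               ∎
    }
    where
    open ≈-Reasoning
    e₁ = digit d₁
    e₂ = digit d₂
    e₃ = digit d₃
    N₂ = e₁ ℕ.+ e₁ ℕ.+ e₂
    N₃ = N₂ ℕ.+ N₂ ℕ.+ e₃
    N₂≤6 : N₂ ℕ.≤ 6
    N₂≤6 = ℕ.+-mono-≤ (ℕ.+-mono-≤ (digit≤2 d₁) (digit≤2 d₁)) (digit≤2 d₂)

  module _ {x} (E : EighthsExpansion x) where
    open EighthsExpansion E

    lower-bound : ∀ {a} k → a + 1# ≈ eighths (ι k) → k ℕ.≤ N → a ≤ x
    lower-bound {a} k a+1≈ k≤N = +-cancelʳ-≤ 1# (begin
      a + 1#              ≈⟨ a+1≈ ⟩
      eighths (ι k)       ≲⟨ eighths-mono-≤ (≤-trans (ι-mono-≤ k≤N) (x≤x+y 0≤w)) ⟩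
      eighths (ι N + w)   ≈⟨ x+1≈eighths ⟨
      x + 1#              ∎)
      where open ≤-Reasoning

    upper-bound : ∀ {b} k → b + 1# ≈ eighths (ι k) → N ℕ.+ 2 ℕ.≤ k → x ≤ b
    upper-bound {b} k b+1≈ N+2≤k = +-cancelʳ-≤ 1# (begin
      x + 1#                ≈⟨ x+1≈eighths ⟩
      eighths (ι N + w)     ≲⟨ eighths-mono-≤ ιN+w≤ιk ⟩
      eighths (ι k)         ≈⟨ b+1≈ ⟨
      b + 1#                ∎)
      where
      open ≤-Reasoning
      ιN+w≤ιk : ι N + w ≤ ι k
      ιN+w≤ιk = begin
        ι N + w         ≲⟨ +-monoʳ-≤ (ι N) w≤2 ⟩
        ι N + (1# + 1#) ≈⟨ +-congˡ ι-2 ⟨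
        ι N + ι 2       ≈⟨ ι-+ N 2 ⟨
        ι (N ℕ.+ 2)     ≲⟨ ι-mono-≤ N+2≤k ⟩
        ι k             ∎

    classify : (⅛ ≤ x × x ≤ 1#) ⊎ ((- 1#) ≤ x × x ≤ (- ⅛)) ⊎ ((- ¼) ≤ x × x ≤ ¼)
    classify with N ℕ.≤? 5 | N ℕ.≤? 8
    ... | yes N≤5 | _       = inj₂ (inj₁ ( lower-bound 0 (neg+1≈eighths 8 0 ≡.refl eighths-ι-8) z≤n
                                         , upper-bound 7 (neg+1≈eighths 1 7 ≡.refl eighths-ι-1) (ℕ.+-monoˡ-≤ 2 N≤5)))
    ... | no N≰5  | yes N≤8 = inj₂ (inj₂ ( lower-bound 6 (neg+1≈eighths 2 6 ≡.refl eighths-ι-2) (ℕ.≰⇒> N≰5)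
                                         , upper-bound 10 (+1≈eighths 2 eighths-ι-2) (ℕ.+-monoˡ-≤ 2 N≤8)))
    ... | no _    | no N≰8  = inj₁ ( lower-bound 9 (+1≈eighths 1 eighths-ι-1) (ℕ.≰⇒> N≰8)
                                 , upper-bound 16 (+1≈eighths 8 eighths-ι-8) (ℕ.+-monoˡ-≤ 2 N≤14))

lemma3p6 : (R : RealField) → let open RealField R in
    ∀ (x : Carrier) → CoI R x →
    (⅛ ≤ x × x ≤ 1#) ⊎ ((- 1#) ≤ x × x ≤ (- ⅛)) ⊎ ((- ¼) ≤ x × x ≤ ¼)
lemma3p6 R x (X , step , Xx) = classify (expansion step Xx)
  where open Expansion R
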